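{- Let $X$ and $Z$ be disjoint finite sets, let $Q$ be a partial order relation on $Z$, and let $y$ be a point not contained in $X \cup Z$. Then the following two numbers are equal: (i) the number of partial order relations $R$ on $X \cup Z$ with $R|_Z = Q$; (ii) the number of partial order relations $R$ on $X \cup Z \cup \{y\}$ with $R|_{Z \cup \{y\}} = Q^d + A_y$ and $\max R = \max(Q^d + A_y)$ (i.e. the maximal points of $R$ are exactly the maximal points of $Q^d$ together with $y$).
   Context: A partial order relation (p.o.r.) on a set $S$ is a reflexive, antisymmetric and transitive subset of $S \times S$. For a p.o.r. $R$ on $S$ and $M \subseteq S$, the induced p.o.r. is $R|_M = R \cap (M \times M)$ (so $R|_M = Q$ means $Q$ is an induced sub-poset of $R$). The dual of $R$ is $R^d = \{(b,a) : (a,b) \in R\}$. $A_y = \{(y,y)\}$ is the singleton poset on $y$. For p.o.r.s $R_1, R_2$ on disjoint carriers, the direct sum is $R_1 + R_2 = R_1 \cup R_2$. For a p.o.r. $R$ on $S$, $\max R$ is the set of $x \in S$ such that $(x,z) \in R$ implies $z = x$. -}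

module Defs where

open import Data.Bool using (Bool; true; false)
open import Data.Bool.Properties using () renaming (_≟_ to _≟ᴮ_)
open import Data.Nat using (ℕ; zero; suc; _+_)
open import Data.Fin using (Fin; zero; suc; _↑ʳ_; splitAt)
open import Data.Fin.Properties using (all?; any?) renaming (_≟_ to _≟ᶠ_)
open import Data.Sum using (inj₁; inj₂)
open import Data.Product using (_×_; _,_; ∃; Σ)
open import Data.Vec using (Vec; []; _∷_; lookup; tabulate)
open import Data.Vec.Properties using (≡-dec)
open import Data.List using (List; []; _∷_; [_]; map; concatMap; filter; length)
open import Relation.Binary.PropositionalEquality using (_≡_; refl)
open import Relation.Nullary using (Dec; yes; no)
open import Relation.Nullary.Decidable using (_×-dec_; _→-dec_)
open import Level using (0ℓ)
open import Relation.Unary using (Pred; Decidable)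

Rel : ℕ → Set
Rel k = Vec (Vec Bool k) k

_∋⟨_,_⟩ : ∀ {k} → Rel k → Fin k → Fin k → Set
R ∋⟨ i , j ⟩ = lookup (lookup R i) j ≡ true

infix 4 _∋⟨_,_⟩

IsPOR : ∀ {k} → Rel k → Set
IsPOR {k} R =
  (∀ (a : Fin k) → R ∋⟨ a , a ⟩) ×
  (∀ (a b : Fin k) → R ∋⟨ a , b ⟩ → R ∋⟨ b , a ⟩ → a ≡ b) ×
  (∀ (a b c : Fin k) → R ∋⟨ a , b ⟩ → R ∋⟨ b , c ⟩ → R ∋⟨ a , c ⟩)

-- induced relation along an embedding f : Fin l → Fin k
-- (R|_M with M = image of f, transported to Fin l)
restrict : ∀ {l k} → (Fin l → Fin k) → Rel k → Rel l
restrict f R = tabulate λ i → tabulate λ j → lookup (lookup R (f i)) (f j)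

dual : ∀ {k} → Rel k → Rel k
dual R = tabulate λ i → tabulate λ j → lookup (lookup R j) i

A₁ : Rel 1
A₁ = (true ∷ []) ∷ []

_⊕_ : ∀ {a b} → Rel a → Rel b → Rel (a + b)
_⊕_ {a} {b} R₁ R₂ = tabulate λ i → tabulate λ j → go (splitAt a i) (splitAt a j)
  where
  go : _ → _ → Bool
  go (inj₁ i) (inj₁ j) = lookup (lookup R₁ i) j
  go (inj₂ i) (inj₂ j) = lookup (lookup R₂ i) j
  go _ _ = false

IsMax : ∀ {k} → Rel k → Fin k → Set
IsMax {k} R x = ∀ (z : Fin k) → R ∋⟨ x , z ⟩ → z ≡ x

∋? : ∀ {k} (R : Rel k) (i j : Fin k) → Dec (R ∋⟨ i , j ⟩)
∋? R i j = lookup (lookup R i) j ≟ᴮ true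

IsPOR? : ∀ {k} (R : Rel k) → Dec (IsPOR R)
IsPOR? R =
  all? (λ a → ∋? R a a) ×-dec
  (all? λ a → all? λ b → ∋? R a b →-dec (∋? R b a →-dec (a ≟ᶠ b))) ×-dec
  (all? λ a → all? λ b → all? λ c → ∋? R a b →-dec (∋? R b c →-dec ∋? R a c))

IsMax? : ∀ {k} (R : Rel k) (x : Fin k) → Dec (IsMax R x)
IsMax? R x = all? λ z → ∋? R x z →-dec (z ≟ᶠ x)

Rel-≟ : ∀ {k} (R S : Rel k) → Dec (R ≡ S)
Rel-≟ = ≡-dec (≡-dec _≟ᴮ_)

allVecs : {A : Set} → List A → (n : ℕ) → List (Vec A n)
allVecs xs zero    = [ [] ]
allVecs xs (suc n) = concatMap (λ x → map (x ∷_) (allVecs xs n)) xs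

allRels : (k : ℕ) → List (Rel k)
allRels k = allVecs (allVecs (true ∷ false ∷ []) k) k

#Rel : (k : ℕ) {P : Pred (Rel k) 0ℓ} → Decidable P → ℕ
#Rel k P? = length (filter P? (allRels k))

-- The setting of the theorem: X = Fin m, Z = Fin n.
-- X ∪ Z = Fin (m + n), X ↦ first m elements, Z ↦ last n (m ↑ʳ_).
-- X ∪ Z ∪ {y} = Fin (suc (m + n)), y = zero, X ∪ Z via suc.

ιZy : ∀ m {n} → Fin (suc n) → Fin (suc (m + n))
ιZy m zero    = zero
ιZy m (suc j) = suc (m ↑ʳ j)

Count₁-P : ∀ m {n} → Rel n → Rel (m + n) → Set
Count₁-P m Q R = IsPOR R × restrict (m ↑ʳ_) R ≡ Q

Count₁-P? : ∀ m {n} (Q : Rel n) → Decidable (Count₁-P m Q)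
Count₁-P? m Q R = IsPOR? R ×-dec Rel-≟ (restrict (m ↑ʳ_) R) Q

-- (ii): R on X ∪ Z ∪ {y} with R|_{Z ∪ {y}} = Q^d + A_y and max R = max(Q^d + A_y)
-- (Q^d + A_y is realised on Fin (1 + n) as A_y ⊕ Q^d, y = zero.)
Count₂-P : ∀ m {n} → Rel n → Rel (suc (m + n)) → Set
Count₂-P m {n} Q R =
  IsPOR R ×
  restrict (ιZy m) R ≡ (A₁ ⊕ dual Q) ×
  (∀ (x : Fin (suc (m + n))) →
     (IsMax R x → ∃ λ (j : Fin (suc n)) → x ≡ ιZy m j × IsMax (A₁ ⊕ dual Q) j) ×
     ((∃ λ (j : Fin (suc n)) → x ≡ ιZy m j × IsMax (A₁ ⊕ dual Q) j) → IsMax R x))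

Count₂-P? : ∀ m {n} (Q : Rel n) → Decidable (Count₂-P m Q)
Count₂-P? m {n} Q R =
  IsPOR? R ×-dec Rel-≟ (restrict (ιZy m) R) (A₁ ⊕ dual Q) ×-dec
  all? (λ x → (IsMax? R x →-dec rhs x) ×-dec (rhs x →-dec IsMax? R x))
  where
  rhs : ∀ x → Dec (∃ λ (j : Fin (suc n)) → x ≡ ιZy m j × IsMax (A₁ ⊕ dual Q) j)
  rhs x = any? λ j → (x ≟ᶠ ιZy m j) ×-dec IsMax? (A₁ ⊕ dual Q) j

-- Let D be the set of points of X ∪ Z with no point of Z below them under R; it is a down-set
-- inside X.  Twist R: reverse it on D and on its complement, and put d ∈ D below u ∉ D exactly
-- when d ≰ u.  Adjoining y above the points of D only gives a partial order whose restriction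
-- to Z ∪ {y} is Q^d + A_y, and whose maximal points are y and the minimal points of the
-- complement of D, which are exactly the minimal points of Q.  Conversely, for R' of the second
-- kind, a point not below y lies under a maximal point of R' other than y, which is in Z; after
-- untwisting it lies above that point, so D is recovered as the set of points below y.  Since
-- twisting along a down-set is an involution, the two constructions are mutually inverse.

module Submission where

open import Defs
open import Data.Bool using (Bool; true; false; not)
open import Data.Bool.Properties using (not-involutive)
open import Data.Fin using (Fin; zero; suc; _↑ʳ_)
open import Data.Fin.Properties using (suc-injective; ↑ʳ-injective; any?) renaming (_≟_ to _≟ᶠ_)
open import Data.Fin.Subset using (_⊂_; ∣_∣)
open import Data.Fin.Subset.Properties using (p⊂q⇒∣p∣<∣q∣)
open import Data.List using (List; []; _∷_; _++_; map; filter; length; concatMap; cartesianProductWith)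
open import Data.List.Properties using (length-map; map-id-local; map-∘)
open import Data.List.Membership.Propositional using (_∈_)
open import Data.List.Membership.Propositional.Properties
  using (∈-map⁺; ∈-map⁻; ∈-filter⁺; ∈-filter⁻; ∈-cartesianProductWith⁺)
open import Data.List.Membership.Propositional.Properties.WithK using (unique∧set⇒bag)
open import Data.List.Relation.Binary.BagAndSetEquality using (_∼[_]_; set; ∼bag⇒↭)
open import Data.List.Relation.Binary.Permutation.Propositional.Properties using (↭-length)
import Data.List.Relation.Unary.All as All
import Data.List.Relation.Unary.AllPairs as AllPairs
open import Data.List.Relation.Unary.Any using (here; there)
open import Data.List.Relation.Unary.Unique.Propositional using (Unique)
open import Data.List.Relation.Unary.Unique.Propositional.Properties as Unique
  using (cartesianProductWith⁺; filter⁺)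
open import Data.Nat using (ℕ; zero; suc; _+_; _<_)
open import Data.Nat.Induction using (<-wellFounded)
open import Data.Product using (_×_; _,_; ∃; proj₁; proj₂)
open import Data.Vec using (Vec; []; _∷_; lookup; tabulate)
open import Data.Vec.Properties
  using (∷-injective; lookup∘tabulate; tabulate∘lookup; tabulate-cong; []=⇒lookup; lookup⇒[]=)
open import Function using (_⇔_; mk⇔; Equivalence; _on_; _∘_)
open import Function.Construct.Composition using (_⇔-∘_)
open import Function.Related.Propositional using (module EquationalReasoning)
open import Induction.WellFounded using (Acc; acc)
open import Level using (0ℓ)
open import Relation.Binary.Construct.On as On using ()
open import Relation.Binary.PropositionalEquality
open import Relation.Nullary using (¬_; contradiction; Dec; yes; no)
open import Relation.Nullary.Decidable using (isNo; _×-dec_; ¬?; decidable-stable)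
open import Relation.Unary using (Pred; Decidable)

private variable k : ℕ

module _ {A B : Set} {xs : List A} {ys : List B} (f : A → B) (g : B → A)
         (f∈ : ∀ {x} → x ∈ xs → f x ∈ ys) (g∈ : ∀ {y} → y ∈ ys → g y ∈ xs)
         (gf : ∀ {x} → x ∈ xs → g (f x) ≡ x) (fg : ∀ {y} → y ∈ ys → f (g y) ≡ y) where

  length-≡-by-bijection : Unique xs → Unique ys → length xs ≡ length ys
  length-≡-by-bijection uxs uys = begin
    length xs         ≡⟨ length-map f xs ⟨
    length (map f xs) ≡⟨ ↭-length (∼bag⇒↭ (unique∧set⇒bag unique-map uys same-elements)) ⟩
    length ys         ∎
    where
    open ≡-Reasoning
    unique-map : Unique (map f xs)
    unique-map = Unique.map⁻ {f = g}
      (subst Unique (trans (sym (map-id-local (All.tabulate gf))) (map-∘ xs)) uxs)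
    same-elements : map f xs ∼[ set ] ys
    same-elements = mk⇔ to from
      where
      to : ∀ {z} → z ∈ map f xs → z ∈ ys
      to z∈ with ∈-map⁻ f z∈
      ... | x , x∈ , refl = f∈ x∈
      from : ∀ {z} → z ∈ ys → z ∈ map f xs
      from z∈ = subst (_∈ map f xs) (fg z∈) (∈-map⁺ f (g∈ z∈))

concatMap-cons≡cartesianProductWith : {A : Set} {n : ℕ} (xs : List A) (vs : List (Vec A n)) →
  concatMap (λ x → map (x ∷_) vs) xs ≡ cartesianProductWith _∷_ xs vs
concatMap-cons≡cartesianProductWith []       vs = refl
concatMap-cons≡cartesianProductWith (x ∷ xs) vs =
  cong (map (x ∷_) vs ++_) (concatMap-cons≡cartesianProductWith xs vs)

allVecs-unique : {A : Set} {xs : List A} → Unique xs → ∀ n → Unique (allVecs xs n)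
allVecs-unique uxs zero    = All.[] AllPairs.∷ AllPairs.[]
allVecs-unique {xs = xs} uxs (suc n) =
  subst Unique (sym (concatMap-cons≡cartesianProductWith xs (allVecs xs n)))
    (cartesianProductWith⁺ _∷_ ∷-injective uxs (allVecs-unique uxs n))

allVecs-complete : {A : Set} {xs : List A} → (∀ x → x ∈ xs) →
  ∀ {n} (v : Vec A n) → v ∈ allVecs xs n
allVecs-complete every []      = here refl
allVecs-complete {xs = xs} every {suc n} (x ∷ v) =
  subst ((x ∷ v) ∈_) (sym (concatMap-cons≡cartesianProductWith xs (allVecs xs n)))
    (∈-cartesianProductWith⁺ _∷_ (every x) (allVecs-complete every v))

every-Bool : ∀ b → b ∈ true ∷ false ∷ []
every-Bool true  = here refl
every-Bool false = there (here refl)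

true∷false-unique : Unique (true ∷ false ∷ [])
true∷false-unique = ((λ ()) All.∷ All.[]) AllPairs.∷ All.[] AllPairs.∷ AllPairs.[]

allRels-unique : ∀ k → Unique (allRels k)
allRels-unique k = allVecs-unique (allVecs-unique true∷false-unique k) k

allRels-complete : ∀ {k} (R : Rel k) → R ∈ allRels k
allRels-complete = allVecs-complete (allVecs-complete every-Bool)

#Rel-≡-by-bijection : ∀ {k k'} {P : Pred (Rel k) 0ℓ} {P' : Pred (Rel k') 0ℓ}
  (P? : Decidable P) (P'? : Decidable P') (f : Rel k → Rel k') (g : Rel k' → Rel k) →
  (∀ R → P R → P' (f R)) → (∀ R → P' R → P (g R)) →
  (∀ R → P R → g (f R) ≡ R) → (∀ R → P' R → f (g R) ≡ R) →
  #Rel k P? ≡ #Rel k' P'?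
#Rel-≡-by-bijection {k} {k'} P? P'? f g fP gP gf fg =
  length-≡-by-bijection f g
    (λ R∈ → ∈-filter⁺ P'? (allRels-complete _) (fP _ (holds P? R∈)))
    (λ R∈ → ∈-filter⁺ P? (allRels-complete _) (gP _ (holds P'? R∈)))
    (λ R∈ → gf _ (holds P? R∈)) (λ R∈ → fg _ (holds P'? R∈))
    (filter⁺ P? (allRels-unique k)) (filter⁺ P'? (allRels-unique k'))
  where
  holds : ∀ {j} {P : Pred (Rel j) 0ℓ} (P? : Decidable P) {R} → R ∈ filter P? (allRels j) → P R
  holds {j} P? R∈ = proj₂ (∈-filter⁻ P? {xs = allRels j} R∈)


BRel : ℕ → Set
BRel k = Fin k → Fin k → Bool

_≐_ : BRel k → BRel k → Set
r ≐ s = ∀ i j → r i j ≡ s i j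

entry : Rel k → BRel k
entry R i j = lookup (lookup R i) j

tabulate₂ : BRel k → Rel k
tabulate₂ r = tabulate λ i → tabulate λ j → r i j

entry-tabulate₂ : (r : BRel k) → entry (tabulate₂ r) ≐ r
entry-tabulate₂ r i j rewrite lookup∘tabulate (λ i → tabulate (r i)) i = lookup∘tabulate (r i) j

entry-ext : {R S : Rel k} → entry R ≐ entry S → R ≡ S
entry-ext {R = R} {S} eq = begin
  R                   ≡⟨ tabulate₂-entry R ⟨
  tabulate₂ (entry R) ≡⟨ tabulate-cong (λ i → tabulate-cong (eq i)) ⟩
  tabulate₂ (entry S) ≡⟨ tabulate₂-entry S ⟩
  S                   ∎
  where
  open ≡-Reasoning
  tabulate₂-entry : (R : Rel k) → tabulate₂ (entry R) ≡ R
  tabulate₂-entry R = trans (tabulate-cong λ i → tabulate∘lookup (lookup R i)) (tabulate∘lookup R)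

IsPartialOrderᵇ : BRel k → Set
IsPartialOrderᵇ {k} r =
  (∀ (a : Fin k) → r a a ≡ true) ×
  (∀ (a b : Fin k) → r a b ≡ true → r b a ≡ true → a ≡ b) ×
  (∀ (a b c : Fin k) → r a b ≡ true → r b c ≡ true → r a c ≡ true)

IsMaxᵇ : BRel k → Fin k → Set
IsMaxᵇ {k} r x = ∀ (z : Fin k) → r x z ≡ true → z ≡ x

isPartialOrderᵇ-resp : {r s : BRel k} → r ≐ s → IsPartialOrderᵇ r → IsPartialOrderᵇ s
isPartialOrderᵇ-resp r≐s (refl′ , antisym , trans′) =
  (λ a → trans (sym (r≐s a a)) (refl′ a)) ,
  (λ a b h₁ h₂ → antisym a b (trans (r≐s a b) h₁) (trans (r≐s b a) h₂)) ,
  (λ a b c h₁ h₂ →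
    trans (sym (r≐s a c)) (trans′ a b c (trans (r≐s a b) h₁) (trans (r≐s b c) h₂)))

isMaxᵇ-resp : {r s : BRel k} → r ≐ s → ∀ {x} → IsMaxᵇ r x → IsMaxᵇ s x
isMaxᵇ-resp r≐s {x} max z h = max z (trans (r≐s x z) h)

isPOR-tabulate₂ : {r : BRel k} → IsPartialOrderᵇ r → IsPOR (tabulate₂ r)
isPOR-tabulate₂ {r = r} = isPartialOrderᵇ-resp (λ i j → sym (entry-tabulate₂ r i j))

isMax-tabulate₂ : {r : BRel k} {x : Fin k} → IsMax (tabulate₂ r) x ⇔ IsMaxᵇ r x
isMax-tabulate₂ {r = r} =
  mk⇔ (isMaxᵇ-resp (entry-tabulate₂ r)) (isMaxᵇ-resp (λ i j → sym (entry-tabulate₂ r i j)))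

entry-restrict : ∀ {l} (f : Fin l → Fin k) (R : Rel k) →
  entry (restrict f R) ≐ λ i j → entry R (f i) (f j)
entry-restrict f R = entry-tabulate₂ λ i j → entry R (f i) (f j)

entry-dual : (R : Rel k) → entry (dual R) ≐ λ i j → entry R j i
entry-dual R = entry-tabulate₂ λ i j → entry R j i

isPartialOrderᵇ-restrict : ∀ {l} {r : BRel k} {f : Fin l → Fin k} →
  (∀ {i j} → f i ≡ f j → i ≡ j) → IsPartialOrderᵇ r → IsPartialOrderᵇ (λ i j → r (f i) (f j))
isPartialOrderᵇ-restrict {f = f} f-inj (refl′ , antisym , trans′) =
  (λ a → refl′ (f a)) ,
  (λ a b h₁ h₂ → f-inj (antisym (f a) (f b) h₁ h₂)) ,
  (λ a b c → trans′ (f a) (f b) (f c))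

not-contravariant : ∀ {x y} → (x ≡ true → y ≡ true) → not y ≡ true → not x ≡ true
not-contravariant {false}         _   _  = refl
not-contravariant {true}  {false} x⇒y _  = x⇒y refl
not-contravariant {true}  {true}  _   ()

DownClosedᵇ : (Fin k → Bool) → BRel k → Set
DownClosedᵇ S r = ∀ u v → r u v ≡ true → S v ≡ true → S u ≡ true

twisted : Bool → Bool → Bool → Bool → Bool
twisted true  true  vu uv = vu
twisted false false vu uv = vu
twisted true  false vu uv = not uv
twisted false true  vu uv = false

twistᵇ : (Fin k → Bool) → BRel k → BRel k
twistᵇ S r u v = twisted (S u) (S v) (r v u) (r u v)

twistᵇ-isPartialOrder : (S : Fin k → Bool) {r : BRel k} →
  IsPartialOrderᵇ r → IsPartialOrderᵇ (twistᵇ S r)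
twistᵇ-isPartialOrder S {r} (refl′ , antisym , trans′) = refl″ , antisym′ , trans″
  where
  refl″ : ∀ a → twistᵇ S r a a ≡ true
  refl″ a with S a
  ... | true  = refl′ a
  ... | false = refl′ a
  antisym′ : ∀ a b → twistᵇ S r a b ≡ true → twistᵇ S r b a ≡ true → a ≡ b
  antisym′ a b h₁ h₂ with S a | S b
  ... | true  | true  = antisym a b h₂ h₁
  ... | false | false = antisym a b h₂ h₁
  ... | false | true  = contradiction h₁ λ ()
  ... | true  | false = contradiction h₂ λ ()
  trans″ : ∀ a b c → twistᵇ S r a b ≡ true → twistᵇ S r b c ≡ true → twistᵇ S r a c ≡ true
  trans″ a b c h₁ h₂ with S a | S b | S c
  ... | true  | true  | true  = trans′ c b a h₂ h₁
  ... | false | false | false = trans′ c b a h₂ h₁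
  ... | false | true  | _     = contradiction h₁ λ ()
  ... | _     | false | true  = contradiction h₂ λ ()
  ... | true  | true  | false = not-contravariant (trans′ b a c h₁) h₂
  ... | true  | false | false = not-contravariant (λ h → trans′ a c b h h₂) h₁

twistᵇ-downClosed : (S : Fin k → Bool) (r : BRel k) → DownClosedᵇ S (twistᵇ S r)
twistᵇ-downClosed S r u v h Sv with S u | S v
... | true  | _    = refl
... | false | true = h

twistᵇ-involutive : {S : Fin k → Bool} {r : BRel k} →
  DownClosedᵇ S r → twistᵇ S (twistᵇ S r) ≐ r
twistᵇ-involutive {S = S} {r} closed u v with S u in Su | S v in Sv
... | true  | true  = refl
... | false | false = refl
... | true  | false = not-involutive (r u v)
... | false | true  with r u v in ruv
...   | true  = contradiction (trans (sym Su) (closed u v ruv Sv)) λ ()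
...   | false = refl

twistᵇ-cong : {S S' : Fin k → Bool} {r r' : BRel k} →
  (∀ a → S a ≡ S' a) → r ≐ r' → twistᵇ S r ≐ twistᵇ S' r'
twistᵇ-cong S≗S' r≐r' u v rewrite S≗S' u | S≗S' v | r≐r' u v | r≐r' v u = refl

isMaxᵇ-twist : {S : Fin k → Bool} {r : BRel k} {a : Fin k} →
  (S a ≡ false × IsMaxᵇ (twistᵇ S r) a) ⇔ (S a ≡ false × ∀ b → S b ≡ false → r b a ≡ true → b ≡ a)
isMaxᵇ-twist {S = S} {r} {a} = mk⇔ to from
  where
  to : S a ≡ false × IsMaxᵇ (twistᵇ S r) a → S a ≡ false × ∀ b → S b ≡ false → r b a ≡ true → b ≡ a
  to (Sa , max) = Sa , λ b Sb h → max b (subst₂ (λ s t → twisted s t (r b a) (r a b) ≡ true) (sym Sa) (sym Sb) h)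
  from : S a ≡ false × (∀ b → S b ≡ false → r b a ≡ true → b ≡ a) → S a ≡ false × IsMaxᵇ (twistᵇ S r) a
  from (Sa , min) = Sa , max
    where
    max : IsMaxᵇ (twistᵇ S r) a
    max b h rewrite Sa with S b in Sb
    ... | false = min b Sb h

coneᵇ : (Fin k → Bool) → BRel k → BRel (suc k)
coneᵇ S r zero    zero    = true
coneᵇ S r zero    (suc b) = false
coneᵇ S r (suc a) zero    = S a
coneᵇ S r (suc a) (suc b) = r a b

coneᵇ-isPartialOrder : {S : Fin k → Bool} {r : BRel k} →
  IsPartialOrderᵇ r → DownClosedᵇ S r → IsPartialOrderᵇ (coneᵇ S r)
coneᵇ-isPartialOrder {S = S} {r} (refl′ , antisym , trans′) closed = refl″ , antisym′ , trans″
  where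
  refl″ : ∀ a → coneᵇ S r a a ≡ true
  refl″ zero    = refl
  refl″ (suc a) = refl′ a
  antisym′ : ∀ a b → coneᵇ S r a b ≡ true → coneᵇ S r b a ≡ true → a ≡ b
  antisym′ zero    zero    _  _  = refl
  antisym′ (suc a) (suc b) h₁ h₂ = cong suc (antisym a b h₁ h₂)
  trans″ : ∀ a b c → coneᵇ S r a b ≡ true → coneᵇ S r b c ≡ true → coneᵇ S r a c ≡ true
  trans″ zero    zero    zero    _  _  = refl
  trans″ (suc a) zero    zero    h₁ _  = h₁
  trans″ (suc a) (suc b) zero    h₁ h₂ = closed a b h₁ h₂
  trans″ (suc a) (suc b) (suc c) h₁ h₂ = trans′ a b c h₁ h₂

coneᵇ-cong : {S S' : Fin k → Bool} {r r' : BRel k} →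
  (∀ a → S a ≡ S' a) → r ≐ r' → coneᵇ S r ≐ coneᵇ S' r'
coneᵇ-cong S≗S' r≐r' zero    zero    = refl
coneᵇ-cong S≗S' r≐r' zero    (suc b) = refl
coneᵇ-cong S≗S' r≐r' (suc a) zero    = S≗S' a
coneᵇ-cong S≗S' r≐r' (suc a) (suc b) = r≐r' a b

isMaxᵇ-cone-zero : {S : Fin k → Bool} {r : BRel k} → IsMaxᵇ (coneᵇ S r) zero
isMaxᵇ-cone-zero zero _ = refl

isMaxᵇ-cone-suc : {S : Fin k → Bool} {r : BRel k} {a : Fin k} →
  IsMaxᵇ (coneᵇ S r) (suc a) ⇔ (S a ≡ false × IsMaxᵇ r a)
isMaxᵇ-cone-suc {S = S} {r} {a} = mk⇔ to from
  where
  to : IsMaxᵇ (coneᵇ S r) (suc a) → S a ≡ false × IsMaxᵇ r a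
  to max with S a in Sa
  ... | true  = contradiction (max zero Sa) λ ()
  ... | false = refl , λ b h → suc-injective (max (suc b) h)
  from : S a ≡ false × IsMaxᵇ r a → IsMaxᵇ (coneᵇ S r) (suc a)
  from (Sa , max) zero    h = contradiction (trans (sym Sa) h) λ ()
  from (Sa , max) (suc b) h = cong suc (max b h)

belowZeroᵇ : BRel (suc k) → Fin k → Bool
belowZeroᵇ r a = r (suc a) zero

tailᵇ : BRel (suc k) → BRel k
tailᵇ r a b = r (suc a) (suc b)

coneᵇ-split : {r : BRel (suc k)} → r zero zero ≡ true → IsMaxᵇ r zero →
  coneᵇ (belowZeroᵇ r) (tailᵇ r) ≐ r
coneᵇ-split r00 max zero    zero    = sym r00
coneᵇ-split {r = r} r00 max zero    (suc b) with r zero (suc b) in h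
... | true  = contradiction (max (suc b) h) λ ()
... | false = refl
coneᵇ-split r00 max (suc a) zero    = refl
coneᵇ-split r00 max (suc a) (suc b) = refl

belowZeroᵇ-downClosed : {r : BRel (suc k)} → IsPartialOrderᵇ r →
  DownClosedᵇ (belowZeroᵇ r) (tailᵇ r)
belowZeroᵇ-downClosed (_ , _ , trans′) u v = trans′ (suc u) (suc v) zero

isNo-false : {A : Set} (a? : Dec A) → isNo a? ≡ false ⇔ A
isNo-false a? = mk⇔ (from a?) (to a?)
  where
  from : ∀ {A} (a? : Dec A) → isNo a? ≡ false → A
  from (yes a) _ = a
  to : ∀ {A} (a? : Dec A) → A → isNo a? ≡ false
  to (yes _) _ = refl
  to (no ¬a) a = contradiction a ¬a

isNo-true : {A : Set} (a? : Dec A) → ¬ A → isNo a? ≡ true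
isNo-true (yes a) ¬a = contradiction a ¬a
isNo-true (no _)  _  = refl

IsMin : Rel k → Fin k → Set
IsMin {k} R x = ∀ (z : Fin k) → R ∋⟨ z , x ⟩ → z ≡ x

isMax-dual : (Q : Rel k) {x : Fin k} → IsMax (dual Q) x ⇔ IsMin Q x
isMax-dual Q = mk⇔
  (isMaxᵇ-resp (entry-dual Q)) (isMaxᵇ-resp (λ i j → sym (entry-dual Q i j)))

entry-A₁⊕ : (R : Rel k) → entry (A₁ ⊕ R) ≐ coneᵇ (λ _ → false) (entry R)
entry-A₁⊕ R = entry-tabulate₂ (coneᵇ (λ _ → false) (entry R))

isMax-A₁⊕-zero : (R : Rel k) → IsMax (A₁ ⊕ R) zero
isMax-A₁⊕-zero R = isMaxᵇ-resp (λ i j → sym (entry-A₁⊕ R i j)) isMaxᵇ-cone-zero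

isMax-A₁⊕-suc : (R : Rel k) {x : Fin k} → IsMax (A₁ ⊕ R) (suc x) ⇔ IsMax R x
isMax-A₁⊕-suc R = mk⇔
  (λ max → proj₂ (Equivalence.to isMaxᵇ-cone-suc (isMaxᵇ-resp (entry-A₁⊕ R) max)))
  (λ max → isMaxᵇ-resp (λ i j → sym (entry-A₁⊕ R i j))
             (Equivalence.from isMaxᵇ-cone-suc (refl , max)))

-- Row a of R, read as a Subset, is the set of points above a.
above-⊂ : {R : Rel k} → IsPOR R → ∀ {a b} → R ∋⟨ a , b ⟩ → ¬ b ≡ a →
  lookup R b ⊂ lookup R a
above-⊂ {R = R} (refl′ , antisym , trans′) {a} {b} a≤b b≢a =
  (λ {x} x∈ → lookup⇒[]= x (lookup R a) (trans′ a b x a≤b ([]=⇒lookup x∈))) ,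
  a , lookup⇒[]= a (lookup R a) (refl′ a) , λ a∈ → b≢a (antisym b a ([]=⇒lookup a∈) a≤b)

maximal-above : (R : Rel k) → IsPOR R → ∀ a → ∃ λ t → R ∋⟨ a , t ⟩ × IsMax R t
maximal-above R por@(refl′ , _ , trans′) a = go a (On.wellFounded (∣_∣ ∘ lookup R) <-wellFounded a)
  where
  go : ∀ a → Acc (_<_ on (∣_∣ ∘ lookup R)) a → ∃ λ t → R ∋⟨ a , t ⟩ × IsMax R t
  go a (acc rec) with any? (λ t → ∋? R a t ×-dec ¬? (t ≟ᶠ a))
  ... | no none =
    a , refl′ a , λ t a≤t → decidable-stable (t ≟ᶠ a) λ t≢a → none (t , a≤t , t≢a)
  ... | yes (t , a≤t , t≢a) with go t (rec (p⊂q⇒∣p∣<∣q∣ (above-⊂ {R = R} por a≤t t≢a)))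
  ...   | u , t≤u , max = u , trans′ a t u a≤t t≤u , max

module Construction (m : ℕ) {n : ℕ} (Q : Rel n) where

  zBelow? : (R : Rel (m + n)) (a : Fin (m + n)) → Dec (∃ λ j → R ∋⟨ m ↑ʳ j , a ⟩)
  zBelow? R a = any? λ j → ∋? R (m ↑ʳ j) a

  noZBelow : Rel (m + n) → Fin (m + n) → Bool
  noZBelow R a = isNo (zBelow? R a)

  adjoinTopᵇ : Rel (m + n) → BRel (suc (m + n))
  adjoinTopᵇ R = coneᵇ (noZBelow R) (twistᵇ (noZBelow R) (entry R))

  adjoinTop : Rel (m + n) → Rel (suc (m + n))
  adjoinTop R = tabulate₂ (adjoinTopᵇ R)

  removeTopᵇ : Rel (suc (m + n)) → BRel (m + n)
  removeTopᵇ R' = twistᵇ (belowZeroᵇ (entry R')) (tailᵇ (entry R'))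

  removeTop : Rel (suc (m + n)) → Rel (m + n)
  removeTop R' = tabulate₂ (removeTopᵇ R')

  noZBelow-false : ∀ R a → noZBelow R a ≡ false ⇔ (∃ λ j → R ∋⟨ m ↑ʳ j , a ⟩)
  noZBelow-false R a = isNo-false (zBelow? R a)

  noZBelow-true : ∀ R a → (∀ j → ¬ R ∋⟨ m ↑ʳ j , a ⟩) → noZBelow R a ≡ true
  noZBelow-true R a none = isNo-true (zBelow? R a) λ (j , h) → none j h

  isMax-A₁⊕dual-suc : ∀ {j} → IsMax (A₁ ⊕ dual Q) (suc j) ⇔ IsMin Q j
  isMax-A₁⊕dual-suc = isMax-dual Q ⇔-∘ isMax-A₁⊕-suc (dual Q)

  isMax-adjoinTop-zero : ∀ R → IsMax (adjoinTop R) zero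
  isMax-adjoinTop-zero R = Equivalence.from (isMax-tabulate₂ {r = adjoinTopᵇ R}) isMaxᵇ-cone-zero

  module _ (R : Rel (m + n)) (por : IsPOR R) where

    private
      refl′ = proj₁ por
      antisym = proj₁ (proj₂ por)
      trans′ = proj₂ (proj₂ por)

    noZBelow-downClosed : DownClosedᵇ (noZBelow R) (entry R)
    noZBelow-downClosed u v u≤v D[v] with noZBelow R u in D[u]
    ... | true  = refl
    ... | false with Equivalence.to (noZBelow-false R u) D[u]
    ...   | j , z≤u = contradiction (trans (sym D[v]) D[v]≡false) λ ()
      where
      D[v]≡false : noZBelow R v ≡ false
      D[v]≡false = Equivalence.from (noZBelow-false R v) (j , trans′ _ u v z≤u u≤v)

    noZBelow-Z : ∀ j → noZBelow R (m ↑ʳ j) ≡ false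
    noZBelow-Z j = Equivalence.from (noZBelow-false R (m ↑ʳ j)) (j , refl′ (m ↑ʳ j))

    removeTop-adjoinTop : removeTop (adjoinTop R) ≡ R
    removeTop-adjoinTop = entry-ext λ u v → begin
      entry (removeTop (adjoinTop R)) u v       ≡⟨ entry-tabulate₂ (removeTopᵇ (adjoinTop R)) u v ⟩
      twistᵇ (belowZeroᵇ r′) (tailᵇ r′) u v     ≡⟨ twistᵇ-cong (λ a → r′≐ (suc a) zero) (λ a b → r′≐ (suc a) (suc b)) u v ⟩
      twistᵇ D (twistᵇ D (entry R)) u v         ≡⟨ twistᵇ-involutive noZBelow-downClosed u v ⟩
      entry R u v                               ∎
      where
      open ≡-Reasoning
      D = noZBelow R
      r′ = entry (adjoinTop R)
      r′≐ = entry-tabulate₂ (adjoinTopᵇ R)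

    module _ (R|Z : restrict (m ↑ʳ_) R ≡ Q) where

      entry-Z : ∀ i j → entry R (m ↑ʳ i) (m ↑ʳ j) ≡ entry Q i j
      entry-Z i j = trans (sym (entry-restrict (m ↑ʳ_) R i j)) (cong (λ T → entry T i j) R|Z)

      minimal-outside-noZBelow : ∀ {a} →
        (noZBelow R a ≡ false × (∀ b → noZBelow R b ≡ false → R ∋⟨ b , a ⟩ → b ≡ a)) ⇔
        (∃ λ j → a ≡ m ↑ʳ j × IsMin Q j)
      minimal-outside-noZBelow {a} = mk⇔ to from
        where
        to : _ → ∃ λ j → a ≡ m ↑ʳ j × IsMin Q j
        to (D[a] , min) with Equivalence.to (noZBelow-false R a) D[a]
        ... | j , z≤a with min (m ↑ʳ j) (noZBelow-Z j) z≤a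
        ...   | refl = j , refl , λ i i≤j →
                ↑ʳ-injective m i j (min (m ↑ʳ i) (noZBelow-Z i) (trans (entry-Z i j) i≤j))
        from : ∃ (λ j → a ≡ m ↑ʳ j × IsMin Q j) → _
        from (j , refl , min) = noZBelow-Z j , λ b D[b] b≤a →
          let (i , i≤b) = Equivalence.to (noZBelow-false R b) D[b]
              i≡j = min i (trans (sym (entry-Z i j)) (trans′ _ b _ i≤b b≤a))
          in antisym b (m ↑ʳ j) b≤a (subst (λ i → R ∋⟨ m ↑ʳ i , b ⟩) i≡j i≤b)

      isMax-adjoinTop-suc : ∀ {a} →
        IsMax (adjoinTop R) (suc a) ⇔ (∃ λ j → a ≡ m ↑ʳ j × IsMin Q j)
      isMax-adjoinTop-suc {a} = begin
        IsMax (adjoinTop R) (suc a)            ∼⟨ isMax-tabulate₂ {r = coneᵇ D (twistᵇ D r)} ⟩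
        IsMaxᵇ (coneᵇ D (twistᵇ D r)) (suc a)  ∼⟨ isMaxᵇ-cone-suc ⟩
        (D a ≡ false × IsMaxᵇ (twistᵇ D r) a)  ∼⟨ isMaxᵇ-twist {r = r} ⟩
        (D a ≡ false × (∀ b → D b ≡ false → r b a ≡ true → b ≡ a))
                                               ∼⟨ minimal-outside-noZBelow ⟩
        (∃ λ j → a ≡ m ↑ʳ j × IsMin Q j)       ∎
        where
        open EquationalReasoning
        D = noZBelow R
        r = entry R

      restrict-adjoinTop : restrict (ιZy m) (adjoinTop R) ≡ A₁ ⊕ dual Q
      restrict-adjoinTop = entry-ext λ i j → begin
        entry (restrict (ιZy m) (adjoinTop R)) i j       ≡⟨ entry-restrict (ιZy m) (adjoinTop R) i j ⟩
        entry (adjoinTop R) (ιZy m i) (ιZy m j)          ≡⟨ entry-tabulate₂ (adjoinTopᵇ R) (ιZy m i) _ ⟩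
        coneᵇ D (twistᵇ D (entry R)) (ιZy m i) (ιZy m j) ≡⟨ on-Zy i j ⟩
        coneᵇ (λ _ → false) (entry (dual Q)) i j         ≡⟨ entry-A₁⊕ (dual Q) i j ⟨
        entry (A₁ ⊕ dual Q) i j                          ∎
        where
        open ≡-Reasoning
        D = noZBelow R
        on-Zy : ∀ i j → coneᵇ D (twistᵇ D (entry R)) (ιZy m i) (ιZy m j) ≡
                        coneᵇ (λ _ → false) (entry (dual Q)) i j
        on-Zy zero    zero    = refl
        on-Zy zero    (suc j) = refl
        on-Zy (suc i) zero    = noZBelow-Z i
        on-Zy (suc i) (suc j) rewrite noZBelow-Z i | noZBelow-Z j =
          trans (entry-Z j i) (sym (entry-dual Q i j))

      maxima-adjoinTop : ∀ x →
        (IsMax (adjoinTop R) x → ∃ λ j → x ≡ ιZy m j × IsMax (A₁ ⊕ dual Q) j) ×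
        ((∃ λ j → x ≡ ιZy m j × IsMax (A₁ ⊕ dual Q) j) → IsMax (adjoinTop R) x)
      maxima-adjoinTop zero    = (λ _ → zero , refl , isMax-A₁⊕-zero (dual Q)) , λ _ → isMax-adjoinTop-zero R
      maxima-adjoinTop (suc a) = to , from
        where
        to : IsMax (adjoinTop R) (suc a) → ∃ λ j → suc a ≡ ιZy m j × IsMax (A₁ ⊕ dual Q) j
        to max with Equivalence.to isMax-adjoinTop-suc max
        ... | j , refl , min = suc j , refl , Equivalence.from isMax-A₁⊕dual-suc min
        from : (∃ λ j → suc a ≡ ιZy m j × IsMax (A₁ ⊕ dual Q) j) → IsMax (adjoinTop R) (suc a)
        from (suc j , refl , max) =
          Equivalence.from isMax-adjoinTop-suc (j , refl , Equivalence.to isMax-A₁⊕dual-suc max)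

  adjoinTop-count₂ : ∀ R → Count₁-P m Q R → Count₂-P m Q (adjoinTop R)
  adjoinTop-count₂ R (por , R|Z) =
    isPOR-tabulate₂
      (coneᵇ-isPartialOrder (twistᵇ-isPartialOrder (noZBelow R) por) (twistᵇ-downClosed (noZBelow R) (entry R))) ,
    restrict-adjoinTop R por R|Z , maxima-adjoinTop R por R|Z

  module _ (R' : Rel (suc (m + n))) (count₂ : Count₂-P m Q R') where

    private
      por = proj₁ count₂
      R'|Zy = proj₁ (proj₂ count₂)
      maxima = proj₂ (proj₂ count₂)
      Y = belowZeroᵇ (entry R')

    entry-Zy : ∀ i j → entry R' (ιZy m i) (ιZy m j) ≡ coneᵇ (λ _ → false) (entry (dual Q)) i j
    entry-Zy i j = begin
      entry R' (ιZy m i) (ιZy m j)              ≡⟨ entry-restrict (ιZy m) R' i j ⟨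
      entry (restrict (ιZy m) R') i j           ≡⟨ cong (λ T → entry T i j) R'|Zy ⟩
      entry (A₁ ⊕ dual Q) i j                   ≡⟨ entry-A₁⊕ (dual Q) i j ⟩
      coneᵇ (λ _ → false) (entry (dual Q)) i j  ∎
      where open ≡-Reasoning

    belowZero-Z : ∀ j → Y (m ↑ʳ j) ≡ false
    belowZero-Z j = entry-Zy (suc j) zero

    isMax-zero : IsMax R' zero
    isMax-zero = proj₂ (maxima zero) (zero , refl , isMax-A₁⊕-zero (dual Q))

    entry-removeTop-Z-above : ∀ j {a} → Y a ≡ true → entry (removeTop R') (m ↑ʳ j) a ≡ false
    entry-removeTop-Z-above j {a} Y[a]
      rewrite entry-tabulate₂ (removeTopᵇ R') (m ↑ʳ j) a | belowZero-Z j | Y[a] = refl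

    entry-removeTop-Z-outside : ∀ j {a} → Y a ≡ false →
      entry (removeTop R') (m ↑ʳ j) a ≡ entry R' (suc a) (suc (m ↑ʳ j))
    entry-removeTop-Z-outside j {a} Y[a]
      rewrite entry-tabulate₂ (removeTopᵇ R') (m ↑ʳ j) a | belowZero-Z j | Y[a] = refl

    restrict-removeTop : restrict (m ↑ʳ_) (removeTop R') ≡ Q
    restrict-removeTop = entry-ext λ i j → begin
      entry (restrict (m ↑ʳ_) (removeTop R')) i j  ≡⟨ entry-restrict (m ↑ʳ_) (removeTop R') i j ⟩
      entry (removeTop R') (m ↑ʳ i) (m ↑ʳ j)       ≡⟨ entry-removeTop-Z-outside i (belowZero-Z j) ⟩
      entry R' (ιZy m (suc j)) (ιZy m (suc i))     ≡⟨ entry-Zy (suc j) (suc i) ⟩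
      entry (dual Q) j i                           ≡⟨ entry-dual Q j i ⟩
      entry Q i j                                  ∎
      where open ≡-Reasoning

    noZBelow-removeTop : ∀ a → noZBelow (removeTop R') a ≡ Y a
    noZBelow-removeTop a with Y a in Y[a]
    ... | true  = noZBelow-true (removeTop R') a λ j h →
          contradiction (trans (sym h) (entry-removeTop-Z-above j Y[a])) λ ()
    ... | false with maximal-above R' por (suc a)
    ...   | zero  , a≤y , _   = contradiction (trans (sym Y[a]) a≤y) λ ()
    ...   | suc b , a≤b , max with proj₁ (maxima (suc b)) max
    ...     | suc j , refl , _ = Equivalence.from (noZBelow-false (removeTop R') a)
                (j , trans (entry-removeTop-Z-outside j Y[a]) a≤b)

    removeTop-count₁ : Count₁-P m Q (removeTop R')
    removeTop-count₁ =
      isPOR-tabulate₂ (twistᵇ-isPartialOrder Y (isPartialOrderᵇ-restrict suc-injective por)) ,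
      restrict-removeTop

    adjoinTop-removeTop : adjoinTop (removeTop R') ≡ R'
    adjoinTop-removeTop = entry-ext λ s t → begin
      entry (adjoinTop G) s t                                 ≡⟨ entry-tabulate₂ (adjoinTopᵇ G) s t ⟩
      coneᵇ (noZBelow G) (twistᵇ (noZBelow G) (entry G)) s t
        ≡⟨ coneᵇ-cong noZBelow-removeTop (twistᵇ-cong noZBelow-removeTop (entry-tabulate₂ (removeTopᵇ R'))) s t ⟩
      coneᵇ Y (twistᵇ Y (twistᵇ Y (tailᵇ r))) s t
        ≡⟨ coneᵇ-cong (λ _ → refl) (twistᵇ-involutive (belowZeroᵇ-downClosed por)) s t ⟩
      coneᵇ Y (tailᵇ r) s t
        ≡⟨ coneᵇ-split {r = r} (proj₁ por zero) isMax-zero s t ⟩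
      r s t                                                   ∎
      where
      open ≡-Reasoning
      G = removeTop R'
      r = entry R'

theorem2 : (m n : ℕ) (Q : Rel n) → IsPOR Q →
    #Rel (m + n) (Count₁-P? m Q) ≡ #Rel (suc (m + n)) (Count₂-P? m Q)
theorem2 m n Q _ =
  #Rel-≡-by-bijection (Count₁-P? m Q) (Count₂-P? m Q) adjoinTop removeTop
    adjoinTop-count₂ removeTop-count₁ (λ R (por , _) → removeTop-adjoinTop R por) adjoinTop-removeTop
  where open Construction m Q
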